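{- Let $X$ be any set and consider the $C$-algebra $\mathbb{3}^{X}$. Then the set of atoms of $\mathbb{3}^{X}$ is $$\mathscr{A}(\mathbb{3}^{X}) = \{ \alpha \in \mathbb{3}^{X} : \text{there exists a unique } x_{o} \in X \text{ such that } \alpha(x_{o}) \in \{T, U\} \}.$$
   Context: $\mathbb{3}$ denotes McCarthy's three-valued $C$-algebra on $\{T,F,U\}$ with operations: $\neg T = F$, $\neg F = T$, $\neg U = U$; $T\wedge x = x$, $F \wedge x = F$, $U \wedge x = U$ for all $x$; $T \vee x = T$, $F \vee x = x$, $U \vee x = U$ for all $x$. $\mathbb{3}^{X}$ is the set of functions $X \to \mathbb{3}$ with operations defined pointwise; its constants are $\mathbf{T},\mathbf{F},\mathbf{U}$ (the constant functions). On a $C$-algebra $M$ with constants $T,F,U$, the partial order is $a \leq b$ iff $a \vee b = b$. An element $a \neq F$ is an atom if for every $b$ with $F \leq b \leq a$ and $b \neq a$ we have $b = F$; $\mathscr{A}(M)$ denotes the set of atoms. -}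

module Defs where

open import Level using (Level; 0ℓ)
open import Data.Sum using (_⊎_)
open import Data.Product using (_×_)
open import Relation.Nullary using (¬_)
open import Relation.Binary.PropositionalEquality using (_≡_)

-- McCarthy's three-valued C-algebra 𝟛 on {T, F, U}
data 𝟛 : Set where
  T F U : 𝟛

¬₃_ : 𝟛 → 𝟛
¬₃ T = F
¬₃ F = T
¬₃ U = U

_∧₃_ : 𝟛 → 𝟛 → 𝟛
T ∧₃ x = x
F ∧₃ x = F
U ∧₃ x = U

_∨₃_ : 𝟛 → 𝟛 → 𝟛
T ∨₃ x = T
F ∨₃ x = x
U ∨₃ x = U

module PowerAlgebra (X : Set) where

  𝟛^X : Set
  𝟛^X = X → 𝟛

  _≈_ : 𝟛^X → 𝟛^X → Set
  a ≈ b = ∀ x → a x ≡ b x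

  ¬ᵖ_ : 𝟛^X → 𝟛^X
  (¬ᵖ a) x = ¬₃ a x

  _∧ᵖ_ : 𝟛^X → 𝟛^X → 𝟛^X
  (a ∧ᵖ b) x = a x ∧₃ b x

  _∨ᵖ_ : 𝟛^X → 𝟛^X → 𝟛^X
  (a ∨ᵖ b) x = a x ∨₃ b x

  𝐓 𝐅 𝐔 : 𝟛^X
  𝐓 _ = T
  𝐅 _ = F
  𝐔 _ = U

  _≤ᵖ_ : 𝟛^X → 𝟛^X → Set
  a ≤ᵖ b = (a ∨ᵖ b) ≈ b

  IsAtom : 𝟛^X → Set
  IsAtom a = ¬ (a ≈ 𝐅) × (∀ b → 𝐅 ≤ᵖ b → b ≤ᵖ a → ¬ (b ≈ a) → b ≈ 𝐅)

module Submission where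

-- The order of 𝟛 is pointwise very simple: b ≤ a forces b = F or b = a.
-- Hence every b ≤ α in 𝟛^X agrees with α wherever b is not F.
--  * (⇐) If α has a single defined point x₀, an element b ≤ α is either
--    F everywhere, or equals α at x₀ and hence everywhere (off x₀ both are
--    F).  So b ≠ α forces b = 𝐅.  This direction is constructive.
--  * (⇒) Using excluded middle, α has a defined point x₀ (otherwise α = 𝐅),
--    and we may form the restriction α↾x₀, equal to α at x₀ and F elsewhere.
--    It lies below α; if another defined point y ≠ x₀ existed, α↾x₀ would
--    differ from α at y, so atomicity forces α↾x₀ = 𝐅, i.e. α x₀ = F.

open import Defs
open import Level using (0ℓ)
open import Data.Product using (_×_; ∃; _,_)
open import Data.Sum using (_⊎_; inj₁; inj₂)
open import Data.Empty using (⊥-elim)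
open import Relation.Nullary using (¬_; yes; no)
open import Relation.Binary.PropositionalEquality using (_≡_; refl; sym; trans; subst)
open import Axiom.ExcludedMiddle using (ExcludedMiddle)
open import Function.Bundles using (_⇔_; mk⇔)

Defined : 𝟛 → Set
Defined a = a ≡ T ⊎ a ≡ U

defined-or-F : ∀ a → Defined a ⊎ a ≡ F
defined-or-F T = inj₁ (inj₁ refl)
defined-or-F F = inj₂ refl
defined-or-F U = inj₁ (inj₂ refl)

defined⇒≢F : ∀ {a} → Defined a → ¬ (a ≡ F)
defined⇒≢F (inj₁ refl) ()
defined⇒≢F (inj₂ refl) ()

below-cases : ∀ b a → b ∨₃ a ≡ a → b ≡ F ⊎ b ≡ a
below-cases T T _ = inj₂ refl
below-cases F _ _ = inj₁ refl
below-cases U U _ = inj₂ refl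
below-cases T F ()
below-cases T U ()
below-cases U T ()
below-cases U F ()

∨₃-idem : ∀ a → a ∨₃ a ≡ a
∨₃-idem T = refl
∨₃-idem F = refl
∨₃-idem U = refl

module _ (X : Set) where
  open PowerAlgebra X

  AtMostOneDefined : 𝟛^X → Set
  AtMostOneDefined α = ∀ y z → Defined (α y) → Defined (α z) → y ≡ z

  below-agrees : ∀ {b α} → b ≤ᵖ α → ∀ x → ¬ (b x ≡ F) → b x ≡ α x
  below-agrees {b} {α} b≤α x bx≢F with below-cases (b x) (α x) (b≤α x)
  ... | inj₁ bx≡F = ⊥-elim (bx≢F bx≡F)
  ... | inj₂ bx≡αx = bx≡αx

  below-F : ∀ {b α} → b ≤ᵖ α → ∀ x → α x ≡ F → b x ≡ F
  below-F {b} {α} b≤α x αx≡F with below-cases (b x) (α x) (b≤α x)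
  ... | inj₁ bx≡F = bx≡F
  ... | inj₂ bx≡αx = trans bx≡αx αx≡F

  -- If α has at most one defined point, every b ≤ α with b ≠ α is 𝐅:
  -- a point where b is not F is the defined point, where b agrees with α,
  -- and then b agrees with α everywhere.
  below-single-defined : ∀ {b α} → AtMostOneDefined α → b ≤ᵖ α → ¬ (b ≈ α) → b ≈ 𝐅
  below-single-defined {b} {α} unique b≤α b≉α x with defined-or-F (b x)
  ... | inj₂ bx≡F = bx≡F
  ... | inj₁ bx-def = ⊥-elim (b≉α b≈α)
    where
      bx≡αx : b x ≡ α x
      bx≡αx = below-agrees b≤α x (defined⇒≢F bx-def)

      b≈α : b ≈ α
      b≈α z with defined-or-F (α z)
      ... | inj₂ αz≡F = trans (below-F b≤α z αz≡F) (sym αz≡F)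
      ... | inj₁ αz-def =
        subst (λ w → b w ≡ α w) (unique x z (subst Defined bx≡αx bx-def) αz-def) bx≡αx

  single-defined⇒atom : ∀ {α} → ∃ (λ x₀ → Defined (α x₀) × (∀ y → Defined (α y) → y ≡ x₀)) →
                        IsAtom α
  single-defined⇒atom {α} (x₀ , αx₀-def , only-x₀) =
      (λ α≈𝐅 → defined⇒≢F αx₀-def (α≈𝐅 x₀))
    , λ b _ → below-single-defined unique
    where
      unique : AtMostOneDefined α
      unique y z αy-def αz-def = trans (only-x₀ y αy-def) (sym (only-x₀ z αz-def))

  module Classical (em : ExcludedMiddle 0ℓ) where

    _↾_ : 𝟛^X → X → 𝟛^X
    (α ↾ x₀) x with em {x ≡ x₀}
    ... | yes _ = α x
    ... | no _ = F

    ↾-below : ∀ α x₀ → (α ↾ x₀) ≤ᵖ α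
    ↾-below α x₀ x with em {x ≡ x₀}
    ... | yes _ = ∨₃-idem (α x)
    ... | no _ = refl

    ↾-at : ∀ α x₀ → (α ↾ x₀) x₀ ≡ α x₀
    ↾-at α x₀ with em {x₀ ≡ x₀}
    ... | yes _ = refl
    ... | no x₀≢x₀ = ⊥-elim (x₀≢x₀ refl)

    ↾-off : ∀ α x₀ y → ¬ (y ≡ x₀) → (α ↾ x₀) y ≡ F
    ↾-off α x₀ y y≢x₀ with em {y ≡ x₀}
    ... | yes y≡x₀ = ⊥-elim (y≢x₀ y≡x₀)
    ... | no _ = refl

    defined-point : ∀ α → ¬ (α ≈ 𝐅) → ∃ (λ x → Defined (α x))
    defined-point α α≉𝐅 with em {∃ (λ x → Defined (α x))}
    ... | yes found = found
    ... | no none = ⊥-elim (α≉𝐅 α≈𝐅)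
      where
        α≈𝐅 : α ≈ 𝐅
        α≈𝐅 x with defined-or-F (α x)
        ... | inj₁ αx-def = ⊥-elim (none (x , αx-def))
        ... | inj₂ αx≡F = αx≡F

    -- An atom has exactly one defined point: a second defined point y
    -- would make α↾x₀ a proper element below α, hence 𝐅, contradicting
    -- α x₀ ≠ F.
    atom⇒single-defined : ∀ {α} → IsAtom α →
                          ∃ (λ x₀ → Defined (α x₀) × (∀ y → Defined (α y) → y ≡ x₀))
    atom⇒single-defined {α} (α≉𝐅 , atomic) with defined-point α α≉𝐅
    ... | x₀ , αx₀-def = x₀ , αx₀-def , only-x₀
      where
        only-x₀ : ∀ y → Defined (α y) → y ≡ x₀
        only-x₀ y αy-def with em {y ≡ x₀}
        ... | yes y≡x₀ = y≡x₀
        ... | no y≢x₀ = ⊥-elim (defined⇒≢F αx₀-def (trans (sym (↾-at α x₀)) ↾-at-x₀≡F))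
          where
            ↾≉α : ¬ ((α ↾ x₀) ≈ α)
            ↾≉α ↾≈α = defined⇒≢F αy-def (trans (sym (↾≈α y)) (↾-off α x₀ y y≢x₀))

            ↾-at-x₀≡F : (α ↾ x₀) x₀ ≡ F
            ↾-at-x₀≡F = atomic (α ↾ x₀) (λ _ → refl) (↾-below α x₀) ↾≉α x₀

theorem2p30 : ExcludedMiddle 0ℓ → (X : Set) → (α : X → 𝟛) →
    PowerAlgebra.IsAtom X α ⇔
      ∃ (λ x₀ → ((α x₀ ≡ T ⊎ α x₀ ≡ U)
        × (∀ y → (α y ≡ T ⊎ α y ≡ U) → y ≡ x₀)))
theorem2p30 em X α =
  mk⇔ (Classical.atom⇒single-defined X em) (single-defined⇒atom X)
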